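{- Let $d>1$ and $m$ be positive integers, and for each positive integer $n$ let $a_n = 2^{2^n}+d$. Assume that $\gcd(a_k,a_l) \le m$ for all distinct positive integers $k \neq l$. If $p > m$ is a prime and $n$ is a positive integer with $p \mid a_n$, then $p \equiv 1 \pmod{2^n}$. -}

module Defs where

open import Data.Nat using (ℕ; _+_; _^_)

a : ℕ → ℕ → ℕ
a d n = 2 ^ (2 ^ n) + d

-- Let p > m be a prime dividing a n, where gcd (a k) (a l) ≤ m for k ≠ l.  Then p
-- divides no other term a k, and the proof consists in producing one if 2^n ∤ p - 1.
--
--  * p = 2 is impossible: 2 ∣ a n forces 2 ∣ d and hence 2 ∣ a (n + 1).
--  * For odd p, Fermat's little theorem gives 2^(p-1) ≡ 1 (mod p), proved here from
--    the row sums of Pascal's triangle: 2^p = Σ_k (p C k) and p ∣ p C k for 0 < k < p.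
--    Consequently 2^N + d ≡ 2^(N + (p-1)Q) + d (mod p) for every N and Q.
--  * Dyadic dichotomy: for every L, either 2^n ∣ L or 2^(n+e) ≡ 2^n (mod L) for some
--    e ≥ 1.  This is proved by induction on n; the key case L = 2^n·u with u odd uses
--    that 2 has a multiplicative order modulo u (pigeonhole on the residues of 2^i).
--  * Applying the dichotomy to L = p - 1, the second alternative gives p ∣ a (n + e)
--    with e ≥ 1, contradicting the gcd bound.  (The hypotheses d > 1, m ≥ 1 are unused.)
module Submission where

open import Defs
open import Data.Nat using (ℕ; _^_; _≤_; _<_; _∸_)
open import Data.Nat.Divisibility using (_∣_)
open import Data.Nat.GCD using (gcd)
open import Data.Nat.Primality using (Prime)
open import Relation.Binary.PropositionalEquality using (_≢_)

open import Data.Nat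
open import Data.Nat.Properties
open import Data.Nat.Divisibility
open import Data.Nat.DivMod using (_%_; _/_; m≡m%n+[m/n]*n; m%n<n)
open import Data.Nat.GCD using (gcd-greatest; gcd[m,n]≢0)
open import Data.Nat.Primality using (euclidsLemma; ¬prime[0]; prime⇒nonTrivial)
open import Data.Nat.Coprimality using (Coprime; prime⇒coprime; coprime-divisor; coprime-+; 1-coprimeTo)
open import Data.Nat.Combinatorics using (_C_; nCk+nC[k+1]≡[n+1]C[k+1]; nCn≡1; nC1≡n; k>n⇒nCk≡0)
open import Data.Nat.Tactic.RingSolver using (solve-∀)
open import Data.Fin using (toℕ; fromℕ<)
open import Data.Fin.Properties using (pigeonhole; toℕ-fromℕ<)
open import Data.Product using (∃; ∃₂; _×_; _,_)
open import Data.Sum using (_⊎_; inj₁; inj₂)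
open import Data.Empty using (⊥; ⊥-elim)
open import Function using (_∘_)
open import Relation.Nullary using (yes; no)
open import Relation.Binary.PropositionalEquality
open ≡-Reasoning

infix 4 _≡1mod_
_≡1mod_ : ℕ → ℕ → Set
x ≡1mod t = ∃ λ c → x ≡ 1 + c * t

∣∸1⇒≡1mod : ∀ {x t} .{{_ : NonZero x}} → t ∣ x ∸ 1 → x ≡1mod t
∣∸1⇒≡1mod {x} (divides c x∸1≡ct) = c , trans (sym (m+[n∸m]≡n (>-nonZero⁻¹ x))) (cong (1 +_) x∸1≡ct)

≡1mod-^ : ∀ {x t} q → x ≡1mod t → x ^ q ≡1mod t
≡1mod-^ zero _ = 0 , refl
≡1mod-^ {x} {t} (suc q) (c , x≡) with ≡1mod-^ q (c , x≡)
... | e , xᵠ≡ = c + e + c * e * t , trans (cong₂ _*_ x≡ xᵠ≡) (multiply c e t)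
  where
  multiply : ∀ c e t → (1 + c * t) * (1 + e * t) ≡ 1 + (c + e + c * e * t) * t
  multiply = solve-∀

absorption : ∀ n k → suc k * (suc n C suc k) ≡ suc n * (n C k)
absorption n zero = trans (+-identityʳ _) (trans (nC1≡n (suc n)) (sym (*-identityʳ (suc n))))
absorption zero (suc k) = *-zeroʳ (suc (suc k))
absorption (suc n) (suc k) = begin
  suc (suc k) * (suc (suc n) C suc (suc k))
    ≡⟨ cong (suc (suc k) *_) (sym (nCk+nC[k+1]≡[n+1]C[k+1] (suc n) (suc k))) ⟩
  suc (suc k) * (suc n C suc k + W)
    ≡⟨ cong (λ z → suc (suc k) * (z + W)) (sym (pascal n k)) ⟩
  suc (suc k) * ((X + Y) + W)
    ≡⟨ regroup k X Y W ⟩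
  (X + Y) + suc k * (X + Y) + suc (suc k) * W
    ≡⟨ cong₂ (λ u v → (X + Y) + u + v) (trans (cong (suc k *_) (pascal n k)) (absorption n k))
                                         (absorption n (suc k)) ⟩
  (X + Y) + suc n * X + suc n * Y
    ≡⟨ collect n X Y ⟩
  suc (suc n) * (X + Y)
    ≡⟨ cong (suc (suc n) *_) (pascal n k) ⟩
  suc (suc n) * (suc n C suc k) ∎
  where
  X = n C k
  Y = n C suc k
  W = suc n C suc (suc k)
  pascal = nCk+nC[k+1]≡[n+1]C[k+1]
  regroup : ∀ k X Y W → suc (suc k) * ((X + Y) + W) ≡ (X + Y) + suc k * (X + Y) + suc (suc k) * W
  regroup = solve-∀
  collect : ∀ n X Y → (X + Y) + suc n * X + suc n * Y ≡ suc (suc n) * (X + Y)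
  collect = solve-∀

-- A prime p divides the interior binomial coefficients p C k, 0 < k < p:
-- it divides k · (p C k) = p · ((p-1) C (k-1)) but not k.
prime∣binomial : ∀ {p} k → Prime p → 0 < k → k < p → p ∣ p C k
prime∣binomial {suc r} (suc k) pr _ k<p
  with euclidsLemma (suc k) (suc r C suc k) pr (divides (r C k) (trans (absorption r k) (*-comm (suc r) (r C k))))
... | inj₁ p∣k = ⊥-elim (<⇒≱ k<p (∣⇒≤ p∣k))
... | inj₂ p∣C = p∣C

rowSum : ℕ → ℕ → ℕ
rowSum n zero = 0
rowSum n (suc j) = rowSum n j + n C j

rowSum-pascal : ∀ n j → rowSum (suc n) (suc j) ≡ rowSum n (suc j) + rowSum n j
rowSum-pascal n zero = refl
rowSum-pascal n (suc j) = begin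
  rowSum (suc n) (suc j) + suc n C suc j
    ≡⟨ cong₂ _+_ (rowSum-pascal n j) (sym (nCk+nC[k+1]≡[n+1]C[k+1] n j)) ⟩
  (rowSum n (suc j) + rowSum n j) + (n C j + n C suc j)
    ≡⟨ shuffle (rowSum n j) (n C j) (n C suc j) ⟩
  rowSum n (suc (suc j)) + rowSum n (suc j) ∎
  where
  shuffle : ∀ a b c → ((a + b) + a) + (b + c) ≡ ((a + b) + c) + (a + b)
  shuffle = solve-∀

rowSum-total : ∀ n → rowSum n (suc n) ≡ 2 ^ n
rowSum-total zero = refl
rowSum-total (suc n) = begin
  rowSum (suc n) (suc (suc n))                       ≡⟨ rowSum-pascal n (suc n) ⟩
  (rowSum n (suc n) + n C suc n) + rowSum n (suc n)
    ≡⟨ cong (λ z → (rowSum n (suc n) + z) + rowSum n (suc n)) (k>n⇒nCk≡0 (n<1+n n)) ⟩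
  (rowSum n (suc n) + 0) + rowSum n (suc n)          ≡⟨ cong (λ z → (z + 0) + z) (rowSum-total n) ⟩
  (2 ^ n + 0) + 2 ^ n                                ≡⟨ double (2 ^ n) ⟩
  2 ^ suc n ∎
  where
  double : ∀ x → (x + 0) + x ≡ 2 * x
  double = solve-∀

rowSum-prime : ∀ {p} → Prime p → ∀ j → j < p → rowSum p (suc j) ≡1mod p
rowSum-prime pr zero _ = 0 , refl
rowSum-prime {p} pr (suc j) j<p with rowSum-prime pr j (<⇒≤ j<p) | prime∣binomial (suc j) pr z<s j<p
... | h , prefix≡ | divides q entry≡ = h + q , (begin
  rowSum p (suc j) + p C suc j ≡⟨ cong₂ _+_ prefix≡ entry≡ ⟩
  (1 + h * p) + q * p          ≡⟨ collect h q p ⟩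
  1 + (h + q) * p ∎)
  where
  collect : ∀ h q p → (1 + h * p) + q * p ≡ 1 + (h + q) * p
  collect = solve-∀

odd-prime-coprime-2 : ∀ {p} → Prime p → p ≢ 2 → Coprime p 2
odd-prime-coprime-2 {p} pr p≢2 =
  prime⇒coprime pr (≤∧≢⇒< (nonTrivial⇒n>1 p {{prime⇒nonTrivial pr}}) (p≢2 ∘ sym))

-- Fermat: 2^(p-1) ≡ 1 (mod p) for odd primes p.  From 2^p = rowSum p p + 1 ≡ 2 we
-- get p ∣ 2·(2^(p-1) - 1), and 2 can be cancelled since p is odd.
fermat-2 : ∀ {p} → Prime p → p ≢ 2 → 2 ^ (p ∸ 1) ≡1mod p
fermat-2 {zero} pr _ = ⊥-elim (¬prime[0] pr)
fermat-2 {suc r} pr p≢2 with rowSum-prime pr r (n<1+n r)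
... | h , rowSum≡ = ∣∸1⇒≡1mod {{m^n≢0 2 r}} (coprime-divisor (odd-prime-coprime-2 pr p≢2) (divides h halved))
  where
  p = suc r
  2^p≡2+hp : 2 ^ p ≡ 2 + h * p
  2^p≡2+hp = begin
    2 ^ p                   ≡⟨ sym (rowSum-total p) ⟩
    rowSum p p + p C p      ≡⟨ cong₂ _+_ rowSum≡ (nCn≡1 p) ⟩
    (1 + h * p) + 1         ≡⟨ +-comm (1 + h * p) 1 ⟩
    2 + h * p ∎
  halved : 2 * (2 ^ r ∸ 1) ≡ h * p
  halved = begin
    2 * (2 ^ r ∸ 1)  ≡⟨ *-distribˡ-∸ 2 (2 ^ r) 1 ⟩
    2 ^ p ∸ 2        ≡⟨ cong (_∸ 2) 2^p≡2+hp ⟩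
    2 + h * p ∸ 2    ≡⟨ m+n∸m≡n 2 (h * p) ⟩
    h * p ∎

%-≡⇒∣∸ : ∀ m n t .{{_ : NonZero t}} → m % t ≡ n % t → t ∣ n ∸ m
%-≡⇒∣∸ m n t m%t≡n%t = divides (n / t ∸ m / t) (begin
  n ∸ m                                      ≡⟨ cong₂ _∸_ (m≡m%n+[m/n]*n n t) (m≡m%n+[m/n]*n m t) ⟩
  (n % t + n / t * t) ∸ (m % t + m / t * t)  ≡⟨ cong (λ r → (n % t + n / t * t) ∸ (r + m / t * t)) m%t≡n%t ⟩
  (n % t + n / t * t) ∸ (n % t + m / t * t)  ≡⟨ [m+n]∸[m+o]≡n∸o (n % t) _ _ ⟩
  n / t * t ∸ m / t * t                      ≡⟨ sym (*-distribʳ-∸ t (n / t) (m / t)) ⟩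
  (n / t ∸ m / t) * t ∎)

^-∸-factor : ∀ x {i j} → i ≤ j → x ^ j ∸ x ^ i ≡ x ^ i * (x ^ (j ∸ i) ∸ 1)
^-∸-factor x {i} {j} i≤j = begin
  x ^ j ∸ x ^ i                      ≡⟨ cong (λ k → x ^ k ∸ x ^ i) (sym (m+[n∸m]≡n i≤j)) ⟩
  x ^ (i + (j ∸ i)) ∸ x ^ i          ≡⟨ cong₂ _∸_ (^-distribˡ-+-* x i (j ∸ i)) (sym (*-identityʳ (x ^ i))) ⟩
  x ^ i * x ^ (j ∸ i) ∸ x ^ i * 1    ≡⟨ sym (*-distribˡ-∸ (x ^ i) (x ^ (j ∸ i)) 1) ⟩
  x ^ i * (x ^ (j ∸ i) ∸ 1) ∎

coprime-^-divisor : ∀ {t x} → Coprime t x → ∀ i z → t ∣ x ^ i * z → t ∣ z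
coprime-^-divisor {t} t⊥x zero z t∣z = subst (t ∣_) (*-identityˡ z) t∣z
coprime-^-divisor {t} {x} t⊥x (suc i) z t∣xxⁱz =
  coprime-^-divisor t⊥x i z (coprime-divisor t⊥x (subst (t ∣_) (*-assoc x (x ^ i) z) t∣xxⁱz))

-- If x is coprime to t, some positive power of x is ≡ 1 (mod t): two of the residues
-- of x^0, …, x^t coincide, and the smaller power cancels from their difference.
order-exists : ∀ {x t} .{{_ : NonZero x}} .{{_ : NonZero t}} → Coprime t x → ∃ λ e → 1 ≤ e × x ^ e ≡1mod t
order-exists {x} {t} t⊥x with pigeonhole (n<1+n t) (λ k → fromℕ< (m%n<n (x ^ toℕ k) t))
... | i , j , i<j , same = toℕ j ∸ toℕ i , m<n⇒0<n∸m i<j , ∣∸1⇒≡1mod {{m^n≢0 x (toℕ j ∸ toℕ i)}} t∣xᵉ∸1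
  where
  same-residue : x ^ toℕ i % t ≡ x ^ toℕ j % t
  same-residue = trans (sym (toℕ-fromℕ< _)) (trans (cong toℕ same) (toℕ-fromℕ< _))
  t∣xᵉ∸1 : t ∣ x ^ (toℕ j ∸ toℕ i) ∸ 1
  t∣xᵉ∸1 = coprime-^-divisor t⊥x (toℕ i) _
    (subst (t ∣_) (^-∸-factor x (<⇒≤ i<j)) (%-≡⇒∣∸ _ _ t same-residue))

even-or-odd : ∀ u → ∃ λ y → u ≡ 2 * y ⊎ u ≡ suc (2 * y)
even-or-odd zero = 0 , inj₁ refl
even-or-odd (suc u) with even-or-odd u
... | y , inj₁ u≡2y   = y , inj₂ (cong suc u≡2y)
... | y , inj₂ u≡1+2y = suc y , inj₁ (trans (cong suc u≡1+2y) (step y))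
  where
  step : ∀ y → suc (suc (2 * y)) ≡ 2 * suc y
  step = solve-∀

odd-coprime-2 : ∀ y → Coprime (suc (2 * y)) 2
odd-coprime-2 zero = 1-coprimeTo 2
odd-coprime-2 (suc y) = subst (λ u → Coprime u 2) (step y) (coprime-+ (odd-coprime-2 y))
  where
  step : ∀ y → 2 + suc (2 * y) ≡ suc (2 * suc y)
  step = solve-∀

-- Either 2^n ∣ L, or 2^n lies on a cycle of the powers of 2 modulo L:
-- 2^(n+e) = 2^n + L·Q with e ≥ 1.  Induction on n; when 2^n ∣ L with odd
-- cofactor u, the order e of 2 modulo u gives 2^(n+1+e) ≡ 2^(n+1) (mod 2^n·u).
dyadic-dichotomy : ∀ L n → 2 ^ n ∣ L ⊎ ∃₂ λ e Q → 1 ≤ e × 2 ^ (n + e) ≡ 2 ^ n + L * Q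
dyadic-dichotomy L zero = inj₁ (1∣ L)
dyadic-dichotomy L (suc n) with dyadic-dichotomy L n
... | inj₂ (e , Q , 1≤e , 2ⁿ⁺ᵉ≡) = inj₂ (e , 2 * Q , 1≤e , (begin
  2 * 2 ^ (n + e)         ≡⟨ cong (2 *_) 2ⁿ⁺ᵉ≡ ⟩
  2 * (2 ^ n + L * Q)     ≡⟨ double (2 ^ n) L Q ⟩
  2 ^ suc n + L * (2 * Q) ∎))
  where
  double : ∀ a L Q → 2 * (a + L * Q) ≡ 2 * a + L * (2 * Q)
  double = solve-∀
... | inj₁ (divides u L≡u2ⁿ) with even-or-odd u
...   | y , inj₁ u≡2y = inj₁ (divides y (begin
  L                ≡⟨ L≡u2ⁿ ⟩
  u * 2 ^ n        ≡⟨ cong (_* 2 ^ n) u≡2y ⟩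
  (2 * y) * 2 ^ n  ≡⟨ swap y (2 ^ n) ⟩
  y * 2 ^ suc n ∎))
  where
  swap : ∀ y a → (2 * y) * a ≡ y * (2 * a)
  swap = solve-∀
...   | y , inj₂ u≡1+2y with order-exists {2} {suc (2 * y)} (odd-coprime-2 y)
...     | e , 1≤e , w , 2ᵉ≡ = inj₂ (e , 2 * w , 1≤e , (begin
  2 ^ (suc n + e)                             ≡⟨ ^-distribˡ-+-* 2 (suc n) e ⟩
  2 ^ suc n * 2 ^ e                           ≡⟨ cong (2 ^ suc n *_) 2ᵉ≡ ⟩
  2 ^ suc n * (1 + w * suc (2 * y))           ≡⟨ expand (2 ^ n) w (suc (2 * y)) ⟩
  2 ^ suc n + (suc (2 * y) * 2 ^ n) * (2 * w) ≡⟨ cong (λ v → 2 ^ suc n + v * (2 * w)) L≡ ⟩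
  2 ^ suc n + L * (2 * w) ∎))
  where
  L≡ : suc (2 * y) * 2 ^ n ≡ L
  L≡ = trans (cong (_* 2 ^ n) (sym u≡1+2y)) (sym L≡u2ⁿ)
  expand : ∀ a w u → (2 * a) * (1 + w * u) ≡ 2 * a + (u * a) * (2 * w)
  expand = solve-∀

period-shift : ∀ {p x L} N Q d → x ^ L ≡1mod p → p ∣ x ^ N + d → p ∣ x ^ (N + L * Q) + d
period-shift {p} {x} {L} N Q d xᴸ≡1 p∣ with ≡1mod-^ Q xᴸ≡1
... | E , xᴸᵠ≡ = subst (p ∣_) (sym shifted) (∣m∣n⇒∣m+n p∣ (n∣m*n (x ^ N * E)))
  where
  shifted : x ^ (N + L * Q) + d ≡ (x ^ N + d) + (x ^ N * E) * p
  shifted = begin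
    x ^ (N + L * Q) + d          ≡⟨ cong (_+ d) (^-distribˡ-+-* x N (L * Q)) ⟩
    x ^ N * x ^ (L * Q) + d      ≡⟨ cong (λ z → x ^ N * z + d) (sym (^-*-assoc x L Q)) ⟩
    x ^ N * (x ^ L) ^ Q + d      ≡⟨ cong (λ z → x ^ N * z + d) xᴸᵠ≡ ⟩
    x ^ N * (1 + E * p) + d      ≡⟨ expand (x ^ N) E p d ⟩
    (x ^ N + d) + (x ^ N * E) * p ∎
    where
    expand : ∀ A E p d → A * (1 + E * p) + d ≡ (A + d) + (A * E) * p
    expand = solve-∀

GcdBounded : ℕ → ℕ → Set
GcdBounded d m = ∀ k l → 1 ≤ k → 1 ≤ l → k ≢ l → gcd (a d k) (a d l) ≤ m

a-positive : ∀ d k → 0 < a d k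
a-positive d k = ≤-trans (m^n>0 2 (2 ^ k)) (m≤m+n _ d)

-- Under the gcd bound, a prime p > m divides at most one term: otherwise p ≤ gcd ≤ m.
large-prime-divides-one-term : ∀ {d m p k l} → GcdBounded d m → m < p → 1 ≤ k → 1 ≤ l → k ≢ l →
  p ∣ a d k → p ∣ a d l → ⊥
large-prime-divides-one-term {d} {m} {p} {k} {l} bound m<p 1≤k 1≤l k≢l p∣aₖ p∣aₗ =
  <⇒≱ m<p (≤-trans (∣⇒≤ {{gcd≢0}} (gcd-greatest p∣aₖ p∣aₗ)) (bound k l 1≤k 1≤l k≢l))
  where
  gcd≢0 : NonZero (gcd (a d k) (a d l))
  gcd≢0 = ≢-nonZero (gcd[m,n]≢0 _ _ (inj₁ (n>0⇒n≢0 (a-positive d k))))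

∣-^ : ∀ x {e} → 0 < e → x ∣ x ^ e
∣-^ x {suc e} _ = m∣m*n (x ^ e)

-- Every 2^(2^k) is even, so 2 divides one term iff it divides d iff it divides all.
even-terms : ∀ {d} k l → 2 ∣ a d k → 2 ∣ a d l
even-terms {d} k l 2∣aₖ = ∣m∣n⇒∣m+n (∣-^ 2 (m^n>0 2 l)) 2∣d
  where
  2∣d : 2 ∣ d
  2∣d = ∣m+n∣m⇒∣n 2∣aₖ (∣-^ 2 (m^n>0 2 k))

lemma2 : (d m : ℕ) → 1 < d → 1 ≤ m →
    (∀ k l → 1 ≤ k → 1 ≤ l → k ≢ l → gcd (a d k) (a d l) ≤ m) →
    (p n : ℕ) → Prime p → m < p → 1 ≤ n → p ∣ a d n →
    2 ^ n ∣ p ∸ 1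
lemma2 d m _ _ bound p n pr m<p 1≤n p∣aₙ with p ≟ 2
... | yes refl = ⊥-elim (large-prime-divides-one-term bound m<p 1≤n z<s (<⇒≢ (n<1+n n))
                          p∣aₙ (even-terms n (suc n) p∣aₙ))
... | no p≢2 with dyadic-dichotomy (p ∸ 1) n
...   | inj₁ 2ⁿ∣p-1 = 2ⁿ∣p-1
...   | inj₂ (e , Q , 1≤e , 2ⁿ⁺ᵉ≡) =
  ⊥-elim (large-prime-divides-one-term bound m<p 1≤n (≤-trans 1≤n (m≤m+n n e)) (<⇒≢ (m<m+n n 1≤e))
                                       p∣aₙ p∣aₙ₊ₑ)
  where
  -- 2^(n+e) ≡ 2^n (mod p - 1) and 2^(p-1) ≡ 1 (mod p), so a (n + e) ≡ a n (mod p).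
  p∣aₙ₊ₑ : p ∣ a d (n + e)
  p∣aₙ₊ₑ = subst (λ E → p ∣ 2 ^ E + d) (sym 2ⁿ⁺ᵉ≡) (period-shift {L = p ∸ 1} (2 ^ n) Q d (fermat-2 pr p≢2) p∣aₙ)
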